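{- Let $G=(V,E)$ be a simple, connected, undirected graph with $V=\{1,\ldots,n\}$ and family of maximal independent sets $\mathscr{M}$. If $A\in\mathscr{M}$ satisfies $Ext(A)=\emptyset$, then $Int(A)=A$.
   Context: The labels give the linear order on $V$; $N(v)$ is the neighbourhood of $v$. For an independent set $A$: $Ext(A)=\{v\in V\setminus A:\ \exists a\in A,\ a\in N(v),\ v>a\}$; for $v\in A$, $Subs(v)=\{u\in N(v): (A\setminus\{v\})\cup\{u\}\text{ independent}\}$, and $v$ is internally active in $A$ if $Subs(v)=\emptyset$ or $v>\max Subs(v)$; $Int(A)$ is the set of internally active vertices of $A$. -}

module Defs where

open import Level using (0ℓ)
open import Data.Nat using (ℕ)
open import Data.Fin using (Fin; _<_)
open import Data.Product using (_×_; ∃)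
open import Data.Sum using (_⊎_)
open import Relation.Nullary using (¬_)
open import Relation.Unary using (Pred; _∈_; _∉_; _⊆_; _≐_; ∅)
open import Relation.Binary.PropositionalEquality using (_≡_; _≢_)
open import Relation.Binary.Construct.Closure.ReflexiveTransitive using (Star)

-- A simple undirected graph on vertex set Fin n (the labels 1..n shifted to 0..n-1;
-- the linear order on vertices is the usual order _<_ on Fin n).
record Graph (n : ℕ) : Set₁ where
  field
    Adj       : Fin n → Fin n → Set
    sym       : ∀ {u v} → Adj u v → Adj v u
    irrefl    : ∀ {v} → ¬ Adj v v

module _ {n : ℕ} (G : Graph n) where
  open Graph G

  Connected : Set
  Connected = ∀ u v → Star Adj u v

  N : Fin n → Pred (Fin n) 0ℓ
  N v u = Adj v u

  Independent : Pred (Fin n) 0ℓ → Set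
  Independent A = ∀ u v → u ∈ A → v ∈ A → ¬ Adj u v

  MaximalIndependent : Pred (Fin n) 0ℓ → Set₁
  MaximalIndependent A =
    Independent A × (∀ (B : Pred (Fin n) 0ℓ) → Independent B → A ⊆ B → B ⊆ A)

  Ext : Pred (Fin n) 0ℓ → Pred (Fin n) 0ℓ
  Ext A v = v ∉ A × ∃ λ a → a ∈ A × a ∈ N v × a < v

  swap : Pred (Fin n) 0ℓ → Fin n → Fin n → Pred (Fin n) 0ℓ
  swap A v u w = (w ∈ A × w ≢ v) ⊎ w ≡ u

  Subs : Pred (Fin n) 0ℓ → Fin n → Pred (Fin n) 0ℓ
  Subs A v u = u ∈ N v × Independent (swap A v u)

  -- v internally active in A: Subs(v) = ∅ or v > max Subs(v),
  -- i.e. every element of Subs(v) is smaller than v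
  InternallyActive : Pred (Fin n) 0ℓ → Fin n → Set
  InternallyActive A v = ∀ u → u ∈ Subs A v → u < v

  Int : Pred (Fin n) 0ℓ → Pred (Fin n) 0ℓ
  Int A v = v ∈ A × InternallyActive A v

-- Every element of Subs(v) is a neighbour of v, and a neighbour u > v of v ∈ A lies
-- outside A by independence, hence in Ext(A); so Ext(A) = ∅ forces all of them below v.

module Submission where

open import Defs
open import Level using (0ℓ)
open import Data.Nat using (ℕ)
open import Data.Fin using (Fin; _<_)
open import Data.Fin.Properties using (<-cmp)
open import Data.Product using (_,_; proj₁)
open import Data.Empty using (⊥-elim)
open import Relation.Binary.Definitions using (tri<; tri≈; tri>)
open import Relation.Binary.PropositionalEquality using (refl)
open import Relation.Unary using (Pred; _∈_; _≐_; ∅)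

module _ {n : ℕ} (G : Graph n) {A : Pred (Fin n) 0ℓ} (indA : Independent G A) where
  open Graph G

  larger-neighbour∈Ext : ∀ {v u} → v ∈ A → u ∈ N G v → v < u → u ∈ Ext G A
  larger-neighbour∈Ext {v} {u} v∈A adj v<u =
    (λ u∈A → indA v u v∈A u∈A adj) , v , v∈A , sym adj , v<u

  neighbours<-if-Ext-empty : (∀ {u} → u ∈ Ext G A → u ∈ ∅) →
                             ∀ {v u} → v ∈ A → u ∈ N G v → u < v
  neighbours<-if-Ext-empty noExt {v} {u} v∈A adj with <-cmp u v
  ... | tri< u<v _ _ = u<v
  ... | tri≈ _ refl _ = ⊥-elim (irrefl adj)
  ... | tri> _ _ v<u = ⊥-elim (noExt (larger-neighbour∈Ext v∈A adj v<u))

proposition1 : (n : ℕ) (G : Graph n) → Connected G →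
    (A : Pred (Fin n) 0ℓ) → MaximalIndependent G A →
    Ext G A ≐ ∅ → Int G A ≐ A
proposition1 n G _ A (indA , _) (noExt , _) =
  proj₁ , λ v∈A → v∈A , λ u (adj , _) → neighbours<-if-Ext-empty G indA noExt v∈A adj
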